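{- Let $G=(V,E)$ be a finite simple undirected graph with $m=|E|\ge1$, $p=1/m$, let $V_1,\dots,V_k$ be a partition of $V$ into nonempty sets, $\psi\in\{\alpha,\phi\}$, $q\in[0,\tfrac12]$, and $s\ge1$. Let $e_1,\dots,e_s$ be edges sampled independently and uniformly at random from $E$, and for $j\in[k]$ let $$f_j=\frac1s\sum_{i=1}^s F_j(e_i),\qquad F_j(e)=\frac{m}{|V_j|}\sum_{v\in V_j}\frac{a_q(v,e)}{|W^*_v|},$$ where $a_q(v,e)=q|\Delta_e|\mathbf{1}[v\in e]+(1-2q)\mathbf{1}[v\in\mathcal{N}_e]$. Then for every $j\in[k]$, $$\mathrm{Var}[f_j]\le\frac{1-p}{sp}\Big(\frac{1}{|V_j|}\sum_{v\in V_j}\psi_v\Big)^2.$$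
   Context: $\mathcal{N}_v$ is the neighborhood of $v$, $d_v=|\mathcal{N}_v|$. For $e=\{u,v\}$, $\mathcal{N}_e=\mathcal{N}_u\cap\mathcal{N}_v$. $\Delta_v$ (resp. $\Delta_e$) is the set of triangles containing node $v$ (resp. edge $e$). $|W^c_v|=\binom{d_v}{2}$, $|W^h_v|=\sum_{u\in\mathcal{N}_v}(d_u-1)$; $\alpha_v=|\Delta_v|/|W^c_v|$ (local clustering coefficient), $\phi_v=2|\Delta_v|/|W^h_v|$ (local closure coefficient). $|W^*_v|=|W^c_v|$ if $\psi=\alpha$ and $|W^*_v|=|W^h_v|/2$ if $\psi=\phi$, so $\psi_v=|\Delta_v|/|W^*_v|$. Convention: quotients with denominator $|W^*_v|=0$ are $0$ (such $v$ lie in no triangle). -}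

module Defs where

open import Data.Bool using (Bool; true; false; if_then_else_; _∧_)
open import Data.Nat as ℕ using (ℕ; zero; suc)
open import Data.Fin using (Fin; _<?_)
open import Data.Fin.Properties using () renaming (_≟_ to _≟ᶠ_)
open import Data.Product using (_×_; _,_; proj₁; proj₂)
open import Data.List using (List; []; _∷_; map; filter; length; allFin; concatMap; foldr)
open import Data.Vec using (Vec; []; _∷_)
open import Data.Rational using (ℚ; 0ℚ; 1ℚ; _+_; _*_; _-_; _÷_; ≢-nonZero)
open import Data.Rational.Properties using (_≟_)
open import Relation.Nullary using (yes; no; does)
open import Relation.Binary.PropositionalEquality using (_≡_)

record SimpleGraph (n : ℕ) : Set where
  field
    adj    : Fin n → Fin n → Bool
    sym    : ∀ u v → adj u v ≡ adj v u
    irrefl : ∀ v → adj v v ≡ false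
open SimpleGraph public

-- Division on ℚ with the convention x / 0 = 0.
_÷₀_ : ℚ → ℚ → ℚ
x ÷₀ y with y ≟ 0ℚ
... | yes _ = 0ℚ
... | no ne = _÷_ x y {{≢-nonZero ne}}

infixl 7 _÷₀_

fromℕ : ℕ → ℚ
fromℕ k = Data.Rational._/_ (Data.Integer.+_ k) 1
  where import Data.Integer

sumℚ : List ℚ → ℚ
sumℚ = foldr _+_ 0ℚ

count : ∀ {n} → (Fin n → Bool) → ℕ
count {n} P = length (filter (λ v → P v ≟b true) (allFin n))
  where
  open import Data.Bool.Properties using () renaming (_≟_ to _≟b_)

sumOver : ∀ {n} → (Fin n → Bool) → (Fin n → ℚ) → ℚ
sumOver {n} P f = sumℚ (map (λ v → if P v then f v else 0ℚ) (allFin n))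

module _ {n : ℕ} (G : SimpleGraph n) where

  -- The edge set E: unordered pairs {u,v} represented as (u , v) with u < v.
  edges : List (Fin n × Fin n)
  edges = concatMap (λ u → concatMap (λ v →
            if does (u <? v) ∧ adj G u v then (u , v) ∷ [] else []) (allFin n)) (allFin n)

  numEdges : ℕ
  numEdges = length edges

  deg : Fin n → ℕ
  deg v = count (adj G v)

  -- v ∈ N_e, for e = {u,w}: N_e = N_u ∩ N_w
  inNe : Fin n × Fin n → Fin n → Bool
  inNe (u , w) v = adj G u v ∧ adj G w v

  inE : Fin n × Fin n → Fin n → Bool
  inE (u , w) v = does (u ≟ᶠ v) Data.Bool.∨ does (w ≟ᶠ v)
    where import Data.Bool

  -- |Δ_e| = |N_e|
  triE : Fin n × Fin n → ℕ
  triE e = count (inNe e)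

  -- |Δ_v| = number of triangles containing v
  --       = number of pairs {u,w} (u < w) with u,w ∈ N_v and u ~ w
  triV : Fin n → ℕ
  triV v = length (filter (λ e → Data.Bool.Properties._≟_ (inNe e v) true) edges)
    where import Data.Bool.Properties

  Wc : Fin n → ℕ
  Wc v = Data.Nat.Combinatorics._C_ (deg v) 2
    where import Data.Nat.Combinatorics

  Wh : Fin n → ℕ
  Wh v = Data.Nat.ListAction.sum (map (λ u → if adj G v u then deg u ℕ.∸ 1 else 0) (allFin n))
    where import Data.Nat.ListAction

data Coeff : Set where
  α φ : Coeff

½ : ℚ
½ = Data.Rational._/_ (Data.Integer.+_ 1) 2
  where import Data.Integer

module _ {n : ℕ} (G : SimpleGraph n) where

  Wstar : Coeff → Fin n → ℚ
  Wstar α v = fromℕ (Wc G v)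
  Wstar φ v = fromℕ (Wh G v) * ½

  psi : Coeff → Fin n → ℚ
  psi ψ v = fromℕ (triV G v) ÷₀ Wstar ψ v

  aq : ℚ → Fin n → Fin n × Fin n → ℚ
  aq q v e = q * fromℕ (triE G e) * (if inE G e v then 1ℚ else 0ℚ)
           + (1ℚ - fromℕ 2 * q) * (if inNe G e v then 1ℚ else 0ℚ)

  inPart : ∀ {k} → (Fin n → Fin k) → Fin k → Fin n → Bool
  inPart part j v = does (part v ≟ᶠ j)

  Fj : ∀ {k} → Coeff → ℚ → (Fin n → Fin k) → Fin k → Fin n × Fin n → ℚ
  Fj ψ q part j e =
    (fromℕ (numEdges G) ÷₀ fromℕ (count (inPart part j)))
      * sumOver (inPart part j) (λ v → aq q v e ÷₀ Wstar ψ v)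

  meanPsi : ∀ {k} → Coeff → (Fin n → Fin k) → Fin k → ℚ
  meanPsi ψ part j = sumOver (inPart part j) (psi ψ) ÷₀ fromℕ (count (inPart part j))

-- All s-tuples of elements of a list (the sample space of s independent
-- uniform draws, each outcome listed once, so uniform measure on the list).
tuples : ∀ {A : Set} → List A → (s : ℕ) → List (Vec A s)
tuples xs zero    = [] ∷ []
tuples xs (suc s) = concatMap (λ x → map (x ∷_) (tuples xs s)) xs

sumVec : ∀ {s} → Vec ℚ s → ℚ
sumVec []       = 0ℚ
sumVec (x ∷ xs) = x + sumVec xs

Expect : ∀ {A : Set} → List A → (s : ℕ) → (Vec A s → ℚ) → ℚ
Expect xs s X = sumℚ (map X (tuples xs s)) ÷₀ fromℕ (length (tuples xs s))

Var : ∀ {A : Set} → List A → (s : ℕ) → (Vec A s → ℚ) → ℚ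
Var xs s X = Expect xs s (λ t → (X t - Expect xs s X) * (X t - Expect xs s X))

module _ {n : ℕ} (G : SimpleGraph n) where

  fj : ∀ {k} → Coeff → ℚ → (Fin n → Fin k) → Fin k → (s : ℕ) → Vec (Fin n × Fin n) s → ℚ
  fj ψ q part j s t = sumVec (Data.Vec.map (Fj G ψ q part j) t) ÷₀ fromℕ s
    where import Data.Vec

-- Drawing the s edges independently and uniformly makes f_j the sample mean of s copies of
-- F_j(e), so for any constant μ its variance is at most E[(f_j - μ)²] = E[(F_j(e) - μ)²] / s.
-- Take μ = E[F_j(e)]: this is the mean of ψ over V_j, because summing a_q(v,e) over all edges
-- gives q·2|Δ_v| + (1 - 2q)|Δ_v| = |Δ_v| (a triangle at v contains two edges at v and is seen
-- once from the edge opposite v). Since F_j ≥ 0, the sum of the squares of F_j is at most the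
-- square of its sum, so E[F_j(e)²] ≤ m μ² and E[(F_j(e) - μ)²] ≤ (m - 1) μ² = ((1 - p)/p) μ².
module Submission where

open import Defs hiding (sym)
open import Data.Nat using (ℕ; _≥_)
open import Data.Fin using (Fin)
open import Data.Product using (∃)
open import Data.Rational using (ℚ; 0ℚ; 1ℚ; _≤_; _*_; _-_)
open import Relation.Binary.PropositionalEquality using (_≡_)

open import Algebra using (Op₂; CommutativeSemigroup)
open import Algebra.Structures using (IsCommutativeMonoid)
open import Data.Bool using (Bool; true; false; if_then_else_; _∧_)
open import Data.Bool.Properties using (∧-comm; ∧-zeroʳ; ∧-identityʳ; ∨-comm) renaming (_≟_ to _≟ᵇ_)
open import Data.Empty using (⊥-elim)
open import Data.Fin using (zero; suc; _<?_)
open import Data.Fin.Properties using (<-cmp) renaming (_≟_ to _≟ᶠ_)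
import Data.Integer as ℤ
import Data.Integer.Properties as ℤ
open import Data.List using (List; []; _∷_; _++_; map; foldr; concatMap; allFin; length; filter)
open import Data.List.Properties using (map-cong; map-∘; map-tabulate; length-++; length-map)
open import Data.Nat as ℕ using (zero; suc)
import Data.Nat.Coprimality as Coprime
import Data.Nat.Properties as ℕ
open import Data.Product using (_×_; _,_)
open import Data.Rational using (_+_; -_; _/_; 1/_; mkℚ; ≢-nonZero; nonNegative; nonPositive)
import Data.Rational.Properties as ℚ
open import Data.Rational.Properties using (_≟_)
open import Data.Sum using (inj₁; inj₂)
open import Data.Vec as Vec using (Vec; []; _∷_)
open import Function using (_∘_; id)
open import Level using (0ℓ)
open import Relation.Binary using (tri<; tri≈; tri>)
open import Relation.Binary.PropositionalEquality
  using (_≢_; refl; sym; trans; cong; cong₂; subst; module ≡-Reasoning)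
open import Relation.Nullary using (does; yes; no)
open import Relation.Nullary.Decidable using (dec⇒maybe; dec-true; dec-false)
open import Tactic.RingSolver using (solve-∀)
open import Tactic.RingSolver.Core.AlmostCommutativeRing
  using (AlmostCommutativeRing; fromCommutativeRing)

module ListSum {A : Set} {_∙_ : Op₂ A} {ε : A}
  (isCommutativeMonoid : IsCommutativeMonoid _≡_ _∙_ ε) where

  open IsCommutativeMonoid isCommutativeMonoid
    using (assoc; identityˡ; identityʳ; isCommutativeSemigroup)

  private
    semigroup : CommutativeSemigroup _ _
    semigroup = record { isCommutativeSemigroup = isCommutativeSemigroup }

  open import Algebra.Properties.CommutativeSemigroup semigroup using (interchange)

  private variable
    B C : Set

  -- Folding over map f makes Defs' sumℚ (map f xs) and sumOver literally instances of ∑.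
  ∑ : List B → (B → A) → A
  ∑ xs f = foldr _∙_ ε (map f xs)

  ∑-cong : ∀ (xs : List B) {f g : B → A} → (∀ x → f x ≡ g x) → ∑ xs f ≡ ∑ xs g
  ∑-cong xs f≗g = cong (foldr _∙_ ε) (map-cong f≗g xs)

  ∑-ε : ∀ (xs : List B) → ∑ xs (λ _ → ε) ≡ ε
  ∑-ε []       = refl
  ∑-ε (x ∷ xs) = trans (identityˡ _) (∑-ε xs)

  ∑-++ : ∀ (xs ys : List B) f → ∑ (xs ++ ys) f ≡ ∑ xs f ∙ ∑ ys f
  ∑-++ []       ys f = sym (identityˡ _)
  ∑-++ (x ∷ xs) ys f = trans (cong (f x ∙_) (∑-++ xs ys f)) (sym (assoc _ _ _))

  ∑-distrib : ∀ (xs : List B) f g → ∑ xs (λ x → f x ∙ g x) ≡ ∑ xs f ∙ ∑ xs g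
  ∑-distrib []       f g = sym (identityˡ ε)
  ∑-distrib (x ∷ xs) f g =
    trans (cong ((f x ∙ g x) ∙_) (∑-distrib xs f g)) (interchange _ _ _ _)

  ∑-if : ∀ (xs : List B) b f → ∑ xs (λ x → if b then f x else ε) ≡ (if b then ∑ xs f else ε)
  ∑-if xs true  f = refl
  ∑-if xs false f = ∑-ε xs

  ∑-map : ∀ (h : C → B) (xs : List C) f → ∑ (map h xs) f ≡ ∑ xs (f ∘ h)
  ∑-map h xs f = cong (foldr _∙_ ε) (sym (map-∘ xs))

  ∑-concatMap : ∀ (h : C → List B) (xs : List C) f →
                ∑ (concatMap h xs) f ≡ ∑ xs (λ x → ∑ (h x) f)
  ∑-concatMap h []       f = refl
  ∑-concatMap h (x ∷ xs) f =
    trans (∑-++ (h x) (concatMap h xs) f) (cong (∑ (h x) f ∙_) (∑-concatMap h xs f))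

  ∑-comm : ∀ (xs : List B) (ys : List C) (f : B → C → A) →
           ∑ xs (λ x → ∑ ys (f x)) ≡ ∑ ys (λ y → ∑ xs (λ x → f x y))
  ∑-comm []       ys f = sym (∑-ε ys)
  ∑-comm (x ∷ xs) ys f =
    trans (cong (∑ ys (f x) ∙_) (∑-comm xs ys f)) (sym (∑-distrib ys (f x) _))

  ∑-tuples-suc : ∀ (xs : List B) (s : ℕ) (g : Vec B (suc s) → A) →
                 ∑ (tuples xs (suc s)) g ≡ ∑ xs (λ x → ∑ (tuples xs s) (λ t → g (x ∷ t)))
  ∑-tuples-suc xs s g =
    trans (∑-concatMap _ xs g) (∑-cong xs (λ x → ∑-map (x ∷_) (tuples xs s) g))

  ∑-allFin-suc : ∀ {n} (f : Fin (suc n) → A) → ∑ (allFin (suc n)) f ≡ f zero ∙ ∑ (allFin n) (f ∘ suc)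
  ∑-allFin-suc {n} f = cong (λ ys → f zero ∙ foldr _∙_ ε ys)
    (trans (map-tabulate suc f) (sym (map-tabulate id (f ∘ suc))))

  ∑-δ : ∀ {n} (v : Fin n) (f : Fin n → A) → ∑ (allFin n) (λ a → if does (a ≟ᶠ v) then f a else ε) ≡ f v
  ∑-δ {suc n} zero    f =
    trans (∑-allFin-suc {n} _) (trans (cong (f zero ∙_) (∑-ε (allFin n))) (identityʳ _))
  ∑-δ {suc n} (suc v) f = trans (∑-allFin-suc {n} _) (trans (identityˡ _) (∑-δ v (f ∘ suc)))

module ℕΣ = ListSum ℕ.+-0-isCommutativeMonoid

module _ where
  open ℕΣ

  length-filter≡∑ : ∀ {A : Set} (P : A → Bool) xs →
    length (filter (λ x → P x ≟ᵇ true) xs) ≡ ∑ xs (λ x → if P x then 1 else 0)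
  length-filter≡∑ P []       = refl
  length-filter≡∑ P (x ∷ xs) with P x
  ... | true  = cong suc (length-filter≡∑ P xs)
  ... | false = length-filter≡∑ P xs

  ∑-ordered-pairs : ∀ {n} (h : Fin n → Fin n → ℕ) → (∀ a b → h a b ≡ h b a) → (∀ a → h a a ≡ 0) →
    let h< : Fin n → Fin n → ℕ
        h< a b = if does (a <? b) then h a b else 0
    in ∑ (allFin n) (λ a → ∑ (allFin n) (h a))
         ≡ ∑ (allFin n) (λ a → ∑ (allFin n) (h< a)) ℕ.+ ∑ (allFin n) (λ a → ∑ (allFin n) (h< a))
  ∑-ordered-pairs {n} h h-sym h-diag = begin
    ∑ vs (λ a → ∑ vs (h a))
      ≡⟨ ∑-cong vs (λ a → ∑-cong vs (split a)) ⟩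
    ∑ vs (λ a → ∑ vs (λ b → h< a b ℕ.+ h< b a))
      ≡⟨ ∑-cong vs (λ a → ∑-distrib vs (h< a) _) ⟩
    ∑ vs (λ a → ∑ vs (h< a) ℕ.+ ∑ vs (λ b → h< b a))
      ≡⟨ ∑-distrib vs _ _ ⟩
    ∑ vs (λ a → ∑ vs (h< a)) ℕ.+ ∑ vs (λ a → ∑ vs (λ b → h< b a))
      ≡⟨ cong (∑ vs (λ a → ∑ vs (h< a)) ℕ.+_) (∑-comm vs vs (λ a b → h< b a)) ⟩
    ∑ vs (λ a → ∑ vs (h< a)) ℕ.+ ∑ vs (λ a → ∑ vs (h< a))
      ∎
    where
    open ≡-Reasoning
    vs = allFin n
    h< : Fin n → Fin n → ℕ
    h< a b = if does (a <? b) then h a b else 0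
    split : ∀ a b → h a b ≡ h< a b ℕ.+ h< b a
    split a b with <-cmp a b
    ... | tri< a<b _ b≮a rewrite dec-true (a <? b) a<b | dec-false (b <? a) b≮a = sym (ℕ.+-identityʳ _)
    ... | tri≈ a≮a refl _ rewrite dec-false (a <? a) a≮a = h-diag a
    ... | tri> a≮b _ b<a rewrite dec-false (a <? b) a≮b | dec-true (b <? a) b<a = h-sym a b

module _ {n : ℕ} (G : SimpleGraph n) where
  open ℕΣ

  private
    vs = allFin n

  ∑-edges : ∀ g → ∑ (edges G) g
    ≡ ∑ vs (λ a → ∑ vs (λ b → if does (a <? b) then (if adj G a b then g (a , b) else 0) else 0))
  ∑-edges g = trans (∑-concatMap _ vs g) (∑-cong vs (λ a →
    trans (∑-concatMap _ vs g) (∑-cong vs (λ b → singleton (does (a <? b)) (adj G a b) (a , b)))))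
    where
    singleton : ∀ c d e → ∑ (if c ∧ d then e ∷ [] else []) g ≡ (if c then (if d then g e else 0) else 0)
    singleton true  true  e = ℕ.+-identityʳ (g e)
    singleton true  false e = refl
    singleton false d     e = refl

  ∑-edges-symmetric : ∀ g → (∀ a b → g (a , b) ≡ g (b , a)) →
    2 ℕ.* ∑ (edges G) g ≡ ∑ vs (λ a → ∑ vs (λ b → if adj G a b then g (a , b) else 0))
  ∑-edges-symmetric g g-sym = begin
    2 ℕ.* ∑ (edges G) g                  ≡⟨ cong (∑ (edges G) g ℕ.+_) (ℕ.+-identityʳ _) ⟩
    ∑ (edges G) g ℕ.+ ∑ (edges G) g      ≡⟨ cong₂ ℕ._+_ (∑-edges g) (∑-edges g) ⟩
    ∑∑ h< ℕ.+ ∑∑ h<                      ≡⟨ sym (∑-ordered-pairs h h-sym h-diag) ⟩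
    ∑∑ h                                 ∎
    where
    open ≡-Reasoning
    ∑∑ : (Fin n → Fin n → ℕ) → ℕ
    ∑∑ f = ∑ vs (λ a → ∑ vs (f a))
    h h< : Fin n → Fin n → ℕ
    h a b = if adj G a b then g (a , b) else 0
    h< a b = if does (a <? b) then h a b else 0
    h-sym : ∀ a b → h a b ≡ h b a
    h-sym a b = cong₂ (λ c z → if c then z else 0) (SimpleGraph.sym G a b) (g-sym a b)
    h-diag : ∀ a → h a a ≡ 0
    h-diag a = cong (λ c → if c then g (a , a) else 0) (SimpleGraph.irrefl G a)

  triE-sym : ∀ a b → triE G (a , b) ≡ triE G (b , a)
  triE-sym a b = begin
    triE G (a , b)
      ≡⟨ length-filter≡∑ (inNe G (a , b)) vs ⟩
    ∑ vs (λ x → if adj G a x ∧ adj G b x then 1 else 0)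
      ≡⟨ ∑-cong vs (λ x → cong (λ c → if c then 1 else 0) (∧-comm (adj G a x) (adj G b x))) ⟩
    ∑ vs (λ x → if adj G b x ∧ adj G a x then 1 else 0)
      ≡⟨ sym (length-filter≡∑ (inNe G (b , a)) vs) ⟩
    triE G (b , a)
      ∎
    where open ≡-Reasoning

  module _ (v : Fin n) where

    2*triV≡∑∑ : 2 ℕ.* triV G v
      ≡ ∑ vs (λ a → ∑ vs (λ b → if adj G a b then (if adj G a v ∧ adj G b v then 1 else 0) else 0))
    2*triV≡∑∑ = trans (cong (2 ℕ.*_) (length-filter≡∑ (λ e → inNe G e v) (edges G)))
      (∑-edges-symmetric _ (λ a b → cong (λ c → if c then 1 else 0) (∧-comm (adj G a v) (adj G b v))))

    private
      J : Fin n → Fin n → ℕ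
      J a b = if adj G a b then triE G (a , b) else 0

      J-sym : ∀ a b → J a b ≡ J b a
      J-sym a b = cong₂ (λ c z → if c then z else 0) (SimpleGraph.sym G a b) (triE-sym a b)

    ∑-common-neighbours : ∑ vs (λ b → if adj G v b then triE G (v , b) else 0) ≡ 2 ℕ.* triV G v
    ∑-common-neighbours = begin
      ∑ vs (J v)
        ≡⟨ ∑-cong vs (λ b → cong (λ z → if adj G v b then z else 0)
                                 (length-filter≡∑ (inNe G (v , b)) vs)) ⟩
      ∑ vs (λ b → if adj G v b then ∑ vs (λ x → if adj G v x ∧ adj G b x then 1 else 0) else 0)
        ≡⟨ ∑-cong vs (λ b → sym (∑-if vs (adj G v b) _)) ⟩
      ∑ vs (λ b → ∑ vs (λ x → if adj G v b then (if adj G v x ∧ adj G b x then 1 else 0) else 0))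
        ≡⟨ ∑-cong vs (λ b → ∑-cong vs (λ x → rotate b x)) ⟩
      ∑ vs (λ b → ∑ vs (λ x → if adj G b x then (if adj G b v ∧ adj G x v then 1 else 0) else 0))
        ≡⟨ sym 2*triV≡∑∑ ⟩
      2 ℕ.* triV G v
        ∎
      where
      open ≡-Reasoning
      rotate-∧ : ∀ p q r → (if p then (if q ∧ r then 1 else 0) else 0)
                         ≡ (if r then (if p ∧ q then 1 else 0) else 0)
      rotate-∧ false q false = refl
      rotate-∧ false q true  = refl
      rotate-∧ true  q false = cong (λ c → if c then 1 else 0) (∧-zeroʳ q)
      rotate-∧ true  q true  = cong (λ c → if c then 1 else 0) (∧-identityʳ q)
      rotate : ∀ b x → (if adj G v b then (if adj G v x ∧ adj G b x then 1 else 0) else 0)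
                     ≡ (if adj G b x then (if adj G b v ∧ adj G x v then 1 else 0) else 0)
      rotate b x = trans (rotate-∧ (adj G v b) (adj G v x) (adj G b x))
        (cong₂ (λ c d → if adj G b x then (if c ∧ d then 1 else 0) else 0)
               (SimpleGraph.sym G v b) (SimpleGraph.sym G v x))

    ∑-incident-triE : ∑ (edges G) (λ e → if inE G e v then triE G e else 0) ≡ 2 ℕ.* triV G v
    ∑-incident-triE = ℕ.*-cancelˡ-≡ _ _ 2 (begin
      2 ℕ.* ∑ (edges G) g
        ≡⟨ ∑-edges-symmetric g g-sym ⟩
      ∑ vs (λ a → ∑ vs (H a))
        ≡⟨ ∑-cong vs (λ a → trans (∑-cong vs (split a)) (∑-distrib vs (at-first a) (at-second a))) ⟩
      ∑ vs (λ a → ∑ vs (at-first a) ℕ.+ ∑ vs (at-second a))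
        ≡⟨ ∑-distrib vs _ _ ⟩
      ∑ vs (λ a → ∑ vs (at-first a)) ℕ.+ ∑ vs (λ a → ∑ vs (at-second a))
        ≡⟨ cong₂ ℕ._+_ first second ⟩
      ∑ vs (J v) ℕ.+ ∑ vs (J v)
        ≡⟨ cong (∑ vs (J v) ℕ.+_) (sym (ℕ.+-identityʳ _)) ⟩
      2 ℕ.* ∑ vs (J v)
        ≡⟨ cong (2 ℕ.*_) ∑-common-neighbours ⟩
      2 ℕ.* (2 ℕ.* triV G v)
        ∎)
      where
      open ≡-Reasoning
      g : Fin n × Fin n → ℕ
      g e = if inE G e v then triE G e else 0
      g-sym : ∀ a b → g (a , b) ≡ g (b , a)
      g-sym a b = cong₂ (λ c z → if c then z else 0)
                        (∨-comm (does (a ≟ᶠ v)) (does (b ≟ᶠ v))) (triE-sym a b)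
      H at-first at-second : Fin n → Fin n → ℕ
      H a b = if adj G a b then g (a , b) else 0
      at-first a b = if does (a ≟ᶠ v) then J a b else 0
      at-second a b = if does (b ≟ᶠ v) then J a b else 0
      split : ∀ a b → H a b ≡ at-first a b ℕ.+ at-second a b
      split a b with a ≟ᶠ v | b ≟ᶠ v
      ... | yes refl | yes refl rewrite SimpleGraph.irrefl G a = refl
      ... | yes _    | no _     = sym (ℕ.+-identityʳ _)
      ... | no _     | yes _    = refl
      ... | no _     | no _     with adj G a b
      ...   | true  = refl
      ...   | false = refl
      first : ∑ vs (λ a → ∑ vs (at-first a)) ≡ ∑ vs (J v)
      first = trans (∑-cong vs (λ a → ∑-if vs (does (a ≟ᶠ v)) (J a))) (∑-δ v (λ a → ∑ vs (J a)))
      second : ∑ vs (λ a → ∑ vs (at-second a)) ≡ ∑ vs (J v)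
      second = ∑-cong vs (λ a → trans (∑-δ v (J a)) (J-sym a v))

ℚ-ring : AlmostCommutativeRing 0ℓ 0ℓ
ℚ-ring = fromCommutativeRing ℚ.+-*-commutativeRing (λ x → dec⇒maybe (0ℚ ≟ x))

fromℕ≡mkℚ : ∀ k → fromℕ k ≡ mkℚ (ℤ.+ k) 0 (Coprime.sym (Coprime.1-coprimeTo k))
fromℕ≡mkℚ k = ℚ.normalize-coprime _

fromℕ-+ : ∀ a b → fromℕ (a ℕ.+ b) ≡ fromℕ a + fromℕ b
fromℕ-+ a b rewrite fromℕ≡mkℚ a | fromℕ≡mkℚ b | ℤ.*-identityʳ (ℤ.+ a) | ℤ.*-identityʳ (ℤ.+ b) = refl

fromℕ-* : ∀ a b → fromℕ (a ℕ.* b) ≡ fromℕ a * fromℕ b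
fromℕ-* a b rewrite fromℕ≡mkℚ a | fromℕ≡mkℚ b = cong (_/ 1) (ℤ.pos-* a b)

fromℕ-suc : ∀ k → fromℕ (suc k) ≡ 1ℚ + fromℕ k
fromℕ-suc = fromℕ-+ 1

fromℕ-nonNeg : ∀ k → 0ℚ ≤ fromℕ k
fromℕ-nonNeg k rewrite fromℕ≡mkℚ k = ℚ.nonNegative⁻¹ _

fromℕ-≢0 : ∀ {k} → 1 ℕ.≤ k → fromℕ k ≢ 0ℚ
fromℕ-≢0 {suc k} _ eq with trans (sym (fromℕ≡mkℚ (suc k))) eq
... | ()

÷₀-as-* : ∀ x y → x ÷₀ y ≡ x * (1ℚ ÷₀ y)
÷₀-as-* x y with y ≟ 0ℚ
... | yes _ = sym (ℚ.*-zeroʳ x)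
... | no _  = cong (x *_) (sym (ℚ.*-identityˡ _))

÷₀-*-cancel : ∀ x {y} → y ≢ 0ℚ → (x ÷₀ y) * y ≡ x
÷₀-*-cancel x {y} y≢0 with y ≟ 0ℚ
... | yes y≡0 = ⊥-elim (y≢0 y≡0)
... | no y≢0′ = begin
  x * (1/ y) * y   ≡⟨ ℚ.*-assoc x _ y ⟩
  x * (1/ y * y)   ≡⟨ cong (x *_) (ℚ.*-inverseˡ y) ⟩
  x * 1ℚ           ≡⟨ ℚ.*-identityʳ x ⟩
  x                ∎
  where
  open ≡-Reasoning
  instance _ = ≢-nonZero y≢0′

*-÷₀-cancel : ∀ x {y} → y ≢ 0ℚ → (x * y) ÷₀ y ≡ x
*-÷₀-cancel x {y} y≢0 with y ≟ 0ℚ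
... | yes y≡0 = ⊥-elim (y≢0 y≡0)
... | no y≢0′ = begin
  x * y * (1/ y)   ≡⟨ ℚ.*-assoc x y _ ⟩
  x * (y * 1/ y)   ≡⟨ cong (x *_) (ℚ.*-inverseʳ y) ⟩
  x * 1ℚ           ≡⟨ ℚ.*-identityʳ x ⟩
  x                ∎
  where
  open ≡-Reasoning
  instance _ = ≢-nonZero y≢0′

inv₀-unique : ∀ {x y} → x * y ≡ 1ℚ → 1ℚ ÷₀ y ≡ x
inv₀-unique {x} {y} xy≡1 = trans (cong (_÷₀ y) (sym xy≡1)) (*-÷₀-cancel x y≢0)
  where
  y≢0 : y ≢ 0ℚ
  y≢0 refl = ℚ.1≢0 (trans (sym xy≡1) (ℚ.*-zeroʳ x))

*-nonNeg : ∀ {x y} → 0ℚ ≤ x → 0ℚ ≤ y → 0ℚ ≤ x * y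
*-nonNeg {x} {y} 0≤x 0≤y =
  ℚ.nonNegative⁻¹ _ {{ℚ.nonNeg*nonNeg⇒nonNeg x {{nonNegative 0≤x}} y {{nonNegative 0≤y}}}}

square-nonNeg : ∀ x → 0ℚ ≤ x * x
square-nonNeg x with ℚ.≤-total 0ℚ x
... | inj₁ 0≤x = *-nonNeg 0≤x 0≤x
... | inj₂ x≤0 = ℚ.nonNegative⁻¹ _ {{ℚ.nonPos*nonPos⇒nonPos x {{x≤0′}} x {{x≤0′}}}}
  where x≤0′ = nonPositive x≤0

inv₀-nonNeg : ∀ {y} → 0ℚ ≤ y → 0ℚ ≤ 1ℚ ÷₀ y
inv₀-nonNeg {y} 0≤y with y ≟ 0ℚ
... | yes _   = ℚ.≤-refl
... | no y≢0 = *-nonNeg {1ℚ} {(1/ y) {{≢-nonZero y≢0}}} (ℚ.nonNegative⁻¹ 1ℚ)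
                       (ℚ.<⇒≤ (ℚ.positive⁻¹ _ {{ℚ.1/pos⇒pos y {{y>0}}}}))
  where
  y>0 = ℚ.nonNeg∧nonZero⇒pos y {{nonNegative 0≤y}} {{≢-nonZero y≢0}}

÷₀-nonNeg : ∀ {x y} → 0ℚ ≤ x → 0ℚ ≤ y → 0ℚ ≤ x ÷₀ y
÷₀-nonNeg {x} {y} 0≤x 0≤y rewrite ÷₀-as-* x y = *-nonNeg 0≤x (inv₀-nonNeg 0≤y)

÷₀-monoˡ-≤ : ∀ {x x′} y → 0ℚ ≤ y → x ≤ x′ → x ÷₀ y ≤ x′ ÷₀ y
÷₀-monoˡ-≤ {x} {x′} y 0≤y x≤x′ rewrite ÷₀-as-* x y | ÷₀-as-* x′ y =
  ℚ.*-monoʳ-≤-nonNeg (1ℚ ÷₀ y) {{nonNegative (inv₀-nonNeg 0≤y)}} x≤x′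

open ListSum ℚ.+-0-isCommutativeMonoid

module _ {A : Set} where

  ∑-*ˡ : ∀ (xs : List A) c X → ∑ xs (λ x → c * X x) ≡ c * ∑ xs X
  ∑-*ˡ []       c X = sym (ℚ.*-zeroʳ c)
  ∑-*ˡ (x ∷ xs) c X = trans (cong (c * X x +_) (∑-*ˡ xs c X)) (sym (ℚ.*-distribˡ-+ c _ _))

  ∑-const : ∀ (xs : List A) c → ∑ xs (λ _ → c) ≡ fromℕ (length xs) * c
  ∑-const []       c = sym (ℚ.*-zeroˡ c)
  ∑-const (x ∷ xs) c = begin
    c + ∑ xs (λ _ → c)            ≡⟨ cong (c +_) (∑-const xs c) ⟩
    c + fromℕ (length xs) * c     ≡⟨ factor c (fromℕ (length xs)) ⟩
    (1ℚ + fromℕ (length xs)) * c  ≡⟨ cong (_* c) (sym (fromℕ-suc (length xs))) ⟩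
    fromℕ (length (x ∷ xs)) * c   ∎
    where
    open ≡-Reasoning
    factor : ∀ c k → c + k * c ≡ (1ℚ + k) * c
    factor = solve-∀ ℚ-ring

  ∑-*ʳ : ∀ (xs : List A) c X → ∑ xs (λ x → X x * c) ≡ ∑ xs X * c
  ∑-*ʳ xs c X = trans (∑-cong xs (λ x → ℚ.*-comm (X x) c)) (trans (∑-*ˡ xs c X) (ℚ.*-comm c _))

  ∑-÷₀ : ∀ (xs : List A) c X → ∑ xs (λ x → X x ÷₀ c) ≡ ∑ xs X ÷₀ c
  ∑-÷₀ xs c X = begin
    ∑ xs (λ x → X x ÷₀ c)          ≡⟨ ∑-cong xs (λ x → ÷₀-as-* (X x) c) ⟩
    ∑ xs (λ x → X x * (1ℚ ÷₀ c))   ≡⟨ ∑-*ʳ xs (1ℚ ÷₀ c) X ⟩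
    ∑ xs X * (1ℚ ÷₀ c)             ≡⟨ sym (÷₀-as-* (∑ xs X) c) ⟩
    ∑ xs X ÷₀ c                    ∎
    where open ≡-Reasoning

  ∑-nonNeg : ∀ (xs : List A) {X} → (∀ x → 0ℚ ≤ X x) → 0ℚ ≤ ∑ xs X
  ∑-nonNeg []       _    = ℚ.≤-refl
  ∑-nonNeg (x ∷ xs) 0≤X = ℚ.+-mono-≤ (0≤X x) (∑-nonNeg xs 0≤X)

  ∑-sq≤sq-∑ : ∀ (xs : List A) {X} → (∀ x → 0ℚ ≤ X x) → ∑ xs (λ x → X x * X x) ≤ ∑ xs X * ∑ xs X
  ∑-sq≤sq-∑ []       _    = ℚ.≤-refl
  ∑-sq≤sq-∑ (x ∷ xs) {X} 0≤X = begin
    X x * X x + ∑ xs (λ x → X x * X x)  ≤⟨ ℚ.+-monoʳ-≤ (X x * X x) (∑-sq≤sq-∑ xs 0≤X) ⟩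
    X x * X x + S * S                   ≡⟨ cong (X x * X x +_) (sym (ℚ.+-identityˡ (S * S))) ⟩
    X x * X x + (0ℚ + S * S)            ≤⟨ ℚ.+-monoʳ-≤ (X x * X x) (ℚ.+-monoˡ-≤ (S * S) cross≥0) ⟩
    X x * X x + ((X x + X x) * S + S * S) ≡⟨ expand (X x) S ⟩
    (X x + S) * (X x + S)               ∎
    where
    open ℚ.≤-Reasoning
    S = ∑ xs X
    cross≥0 : 0ℚ ≤ (X x + X x) * S
    cross≥0 = *-nonNeg (ℚ.+-mono-≤ (0≤X x) (0≤X x)) (∑-nonNeg xs 0≤X)
    expand : ∀ a b → a * a + ((a + a) * b + b * b) ≡ (a + b) * (a + b)
    expand = solve-∀ ℚ-ring

  fromℕ-∑ : ∀ (xs : List A) X → fromℕ (ℕΣ.∑ xs X) ≡ ∑ xs (λ x → fromℕ (X x))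
  fromℕ-∑ []       X = refl
  fromℕ-∑ (x ∷ xs) X = trans (fromℕ-+ (X x) _) (cong (fromℕ (X x) +_) (fromℕ-∑ xs X))

-- Expect xs s X unfolds to mean (tuples xs s) X.
mean : {A : Set} → List A → (A → ℚ) → ℚ
mean xs X = ∑ xs X ÷₀ fromℕ (length xs)

module _ {A : Set} where

  mean-cong : ∀ (xs : List A) {X Y} → (∀ x → X x ≡ Y x) → mean xs X ≡ mean xs Y
  mean-cong xs X≗Y = cong (_÷₀ fromℕ (length xs)) (∑-cong xs X≗Y)

  mean-+ : ∀ (xs : List A) X Y → mean xs (λ x → X x + Y x) ≡ mean xs X + mean xs Y
  mean-+ xs X Y = begin
    ∑ xs (λ x → X x + Y x) ÷₀ n        ≡⟨ ÷₀-as-* _ n ⟩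
    ∑ xs (λ x → X x + Y x) * n⁻¹       ≡⟨ cong (_* n⁻¹) (∑-distrib xs X Y) ⟩
    (∑ xs X + ∑ xs Y) * n⁻¹            ≡⟨ ℚ.*-distribʳ-+ n⁻¹ (∑ xs X) (∑ xs Y) ⟩
    ∑ xs X * n⁻¹ + ∑ xs Y * n⁻¹        ≡⟨ sym (cong₂ _+_ (÷₀-as-* _ n) (÷₀-as-* _ n)) ⟩
    mean xs X + mean xs Y              ∎
    where
    open ≡-Reasoning
    n = fromℕ (length xs)
    n⁻¹ = 1ℚ ÷₀ n

  mean-*ˡ : ∀ (xs : List A) c X → mean xs (λ x → c * X x) ≡ c * mean xs X
  mean-*ˡ xs c X = begin
    ∑ xs (λ x → c * X x) ÷₀ n   ≡⟨ cong (_÷₀ n) (∑-*ˡ xs c X) ⟩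
    (c * ∑ xs X) ÷₀ n           ≡⟨ ÷₀-as-* _ n ⟩
    c * ∑ xs X * (1ℚ ÷₀ n)      ≡⟨ ℚ.*-assoc c _ _ ⟩
    c * (∑ xs X * (1ℚ ÷₀ n))    ≡⟨ cong (c *_) (sym (÷₀-as-* _ n)) ⟩
    c * mean xs X               ∎
    where
    open ≡-Reasoning
    n = fromℕ (length xs)

  mean-*ʳ : ∀ (xs : List A) c X → mean xs (λ x → X x * c) ≡ mean xs X * c
  mean-*ʳ xs c X =
    trans (mean-cong xs (λ x → ℚ.*-comm (X x) c)) (trans (mean-*ˡ xs c X) (ℚ.*-comm c _))

  mean-const : ∀ (xs : List A) c → 1 ℕ.≤ length xs → mean xs (λ _ → c) ≡ c
  mean-const xs c xs≢[] = begin
    ∑ xs (λ _ → c) ÷₀ n  ≡⟨ cong (_÷₀ n) (trans (∑-const xs c) (ℚ.*-comm n c)) ⟩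
    (c * n) ÷₀ n         ≡⟨ *-÷₀-cancel c (fromℕ-≢0 xs≢[]) ⟩
    c                    ∎
    where
    open ≡-Reasoning
    n = fromℕ (length xs)

  -- No nonemptiness needed: for [] both sides are 0, as 0 ÷₀ 0 = 0.
  ∑≡mean*length : ∀ (xs : List A) X → ∑ xs X ≡ mean xs X * fromℕ (length xs)
  ∑≡mean*length []       X = refl
  ∑≡mean*length (x ∷ xs) X = sym (÷₀-*-cancel _ (fromℕ-≢0 {length (x ∷ xs)} (ℕ.s≤s ℕ.z≤n)))

  mean-centred : ∀ (xs : List A) X → 1 ℕ.≤ length xs → mean xs (λ x → X x - mean xs X) ≡ 0ℚ
  mean-centred xs X xs≢[] = begin
    mean xs (λ x → X x - E)           ≡⟨ mean-+ xs X (λ _ → - E) ⟩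
    E + mean xs (λ _ → - E)           ≡⟨ cong (E +_) (mean-const xs (- E) xs≢[]) ⟩
    E - E                             ≡⟨ ℚ.+-inverseʳ E ⟩
    0ℚ                                ∎
    where
    open ≡-Reasoning
    E = mean xs X

  mean-square-shift : ∀ (xs : List A) a X → 1 ℕ.≤ length xs →
    mean xs (λ x → (a + X x) * (a + X x)) ≡ a * a + ((a + a) * mean xs X + mean xs (λ x → X x * X x))
  mean-square-shift xs a X xs≢[] = begin
    mean xs (λ x → (a + X x) * (a + X x))
      ≡⟨ mean-cong xs (λ x → expand a (X x)) ⟩
    mean xs (λ x → a * a + ((a + a) * X x + X x * X x))
      ≡⟨ mean-+ xs (λ _ → a * a) _ ⟩
    mean xs (λ _ → a * a) + mean xs (λ x → (a + a) * X x + X x * X x)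
      ≡⟨ cong₂ _+_ (mean-const xs (a * a) xs≢[]) (mean-+ xs (λ x → (a + a) * X x) _) ⟩
    a * a + (mean xs (λ x → (a + a) * X x) + mean xs (λ x → X x * X x))
      ≡⟨ cong (λ m → a * a + (m + mean xs (λ x → X x * X x))) (mean-*ˡ xs (a + a) X) ⟩
    a * a + ((a + a) * mean xs X + mean xs (λ x → X x * X x))
      ∎
    where
    open ≡-Reasoning
    expand : ∀ a b → (a + b) * (a + b) ≡ a * a + ((a + a) * b + b * b)
    expand = solve-∀ ℚ-ring

  variance≤meanSquareDeviation : ∀ (xs : List A) X c → 1 ℕ.≤ length xs →
    mean xs (λ x → (X x - mean xs X) * (X x - mean xs X)) ≤ mean xs (λ x → (X x - c) * (X x - c))
  variance≤meanSquareDeviation xs X c xs≢[] = begin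
    V
      ≡⟨ sym (ℚ.+-identityʳ V) ⟩
    V + 0ℚ
      ≤⟨ ℚ.+-monoʳ-≤ V (square-nonNeg d) ⟩
    V + d * d
      ≡⟨ regroup V d ⟩
    d * d + ((d + d) * 0ℚ + V)
      ≡⟨ cong (λ m → d * d + ((d + d) * m + V)) (sym (mean-centred xs X xs≢[])) ⟩
    d * d + ((d + d) * mean xs Y + V)
      ≡⟨ sym (mean-square-shift xs d Y xs≢[]) ⟩
    mean xs (λ x → (d + Y x) * (d + Y x))
      ≡⟨ mean-cong xs (λ x → cong (λ z → z * z) (shift (X x) c E)) ⟩
    mean xs (λ x → (X x - c) * (X x - c))
      ∎
    where
    open ℚ.≤-Reasoning
    E = mean xs X
    V = mean xs (λ x → (X x - E) * (X x - E))
    d = E - c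
    Y : A → ℚ
    Y x = X x - E
    regroup : ∀ v d → v + d * d ≡ d * d + ((d + d) * 0ℚ + v)
    regroup = solve-∀ ℚ-ring
    shift : ∀ x c e → e - c + (x - e) ≡ x - c
    shift = solve-∀ ℚ-ring

length-tuples : ∀ {A : Set} (xs : List A) s → length (tuples xs s) ≡ length xs ℕ.^ s
length-tuples xs zero    = refl
length-tuples xs (suc s) = trans (length-prepend xs) (cong (length xs ℕ.*_) (length-tuples xs s))
  where
  length-prepend : ∀ ys → length (concatMap (λ y → map (y ∷_) (tuples xs s)) ys)
                          ≡ length ys ℕ.* length (tuples xs s)
  length-prepend []       = refl
  length-prepend (y ∷ ys) = trans (length-++ (map (y ∷_) (tuples xs s)))
    (cong₂ ℕ._+_ (length-map (y ∷_) (tuples xs s)) (length-prepend ys))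

module _ {A : Set} (xs : List A) (xs≢[] : 1 ℕ.≤ length xs) where

  tuples≢[] : ∀ s → 1 ℕ.≤ length (tuples xs s)
  tuples≢[] s rewrite length-tuples xs s = ℕ.m^n>0 (length xs) {{ℕ.>-nonZero xs≢[]}} s

  mean-tuples-suc : ∀ s g →
    mean (tuples xs (suc s)) g ≡ mean xs (λ x → mean (tuples xs s) (λ t → g (x ∷ t)))
  mean-tuples-suc s g = begin
    ∑ (tuples xs (suc s)) g ÷₀ fromℕ (length (tuples xs (suc s)))  ≡⟨ cong₂ _÷₀_ total size ⟩
    (R * (M * N)) ÷₀ (M * N)                                       ≡⟨ *-÷₀-cancel R MN≢0 ⟩
    R                                                              ∎
    where
    open ≡-Reasoning
    M = fromℕ (length xs)
    N = fromℕ (length (tuples xs s))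
    h : A → ℚ
    h x = mean (tuples xs s) (λ t → g (x ∷ t))
    R = mean xs h
    size : fromℕ (length (tuples xs (suc s))) ≡ M * N
    size = trans (cong fromℕ (trans (length-tuples xs (suc s))
                                    (cong (length xs ℕ.*_) (sym (length-tuples xs s)))))
                 (fromℕ-* (length xs) _)
    MN≢0 : M * N ≢ 0ℚ
    MN≢0 MN≡0 = fromℕ-≢0 (tuples≢[] (suc s)) (trans size MN≡0)
    total : ∑ (tuples xs (suc s)) g ≡ R * (M * N)
    total = begin
      ∑ (tuples xs (suc s)) g
        ≡⟨ ∑-tuples-suc xs s g ⟩
      ∑ xs (λ x → ∑ (tuples xs s) (λ t → g (x ∷ t)))
        ≡⟨ ∑-cong xs (λ x → ∑≡mean*length (tuples xs s) _) ⟩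
      ∑ xs (λ x → h x * N)
        ≡⟨ ∑-*ʳ xs N h ⟩
      ∑ xs h * N
        ≡⟨ cong (_* N) (∑≡mean*length xs h) ⟩
      R * M * N
        ≡⟨ ℚ.*-assoc R M N ⟩
      R * (M * N)
        ∎

  mean-square-sumVec : ∀ (G : A → ℚ) → mean xs G ≡ 0ℚ → ∀ s →
    mean (tuples xs s) (λ t → sumVec (Vec.map G t) * sumVec (Vec.map G t))
      ≡ fromℕ s * mean xs (λ x → G x * G x)
  mean-square-sumVec G centred zero    = sym (ℚ.*-zeroˡ (mean xs (λ x → G x * G x)))
  mean-square-sumVec G centred (suc s) = begin
    mean (tuples xs (suc s)) (λ t → S t * S t)
      ≡⟨ mean-tuples-suc s (λ t → S t * S t) ⟩
    mean xs (λ x → mean (tuples xs s) (λ t → (G x + S t) * (G x + S t)))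
      ≡⟨ mean-cong xs (λ x → mean-square-shift (tuples xs s) (G x) S (tuples≢[] s)) ⟩
    mean xs (λ x → G x * G x + ((G x + G x) * ES + ES²))
      ≡⟨ mean-+ xs (λ x → G x * G x) _ ⟩
    EG² + mean xs (λ x → (G x + G x) * ES + ES²)
      ≡⟨ cong (EG² +_) (mean-+ xs (λ x → (G x + G x) * ES) (λ _ → ES²)) ⟩
    EG² + (mean xs (λ x → (G x + G x) * ES) + mean xs (λ _ → ES²))
      ≡⟨ cong₂ (λ a b → EG² + (a + b)) (mean-*ʳ xs ES (λ x → G x + G x)) (mean-const xs ES² xs≢[]) ⟩
    EG² + (mean xs (λ x → G x + G x) * ES + ES²)
      ≡⟨ cong (λ a → EG² + (a * ES + ES²)) (trans (mean-+ xs G G) (cong₂ _+_ centred centred)) ⟩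
    EG² + ((0ℚ + 0ℚ) * ES + ES²)
      ≡⟨ cong (λ b → EG² + ((0ℚ + 0ℚ) * ES + b)) (mean-square-sumVec G centred s) ⟩
    EG² + ((0ℚ + 0ℚ) * ES + fromℕ s * EG²)
      ≡⟨ collect EG² ES (fromℕ s) ⟩
    (1ℚ + fromℕ s) * EG²
      ≡⟨ cong (_* EG²) (sym (fromℕ-suc s)) ⟩
    fromℕ (suc s) * EG²
      ∎
    where
    open ≡-Reasoning
    S : ∀ {k} → Vec A k → ℚ
    S t = sumVec (Vec.map G t)
    EG² = mean xs (λ x → G x * G x)
    ES = mean (tuples xs s) S
    ES² = mean (tuples xs s) (λ t → S t * S t)
    collect : ∀ v e k → v + ((0ℚ + 0ℚ) * e + k * v) ≡ (1ℚ + k) * v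
    collect = solve-∀ ℚ-ring

[M-1]v/σ≡[1-p]v/[σp] : ∀ {M σ} → M ≢ 0ℚ → σ ≢ 0ℚ → ∀ v →
  ((M - 1ℚ) * v) ÷₀ σ ≡ ((1ℚ - 1ℚ ÷₀ M) ÷₀ (σ * (1ℚ ÷₀ M))) * v
[M-1]v/σ≡[1-p]v/[σp] {M} {σ} M≢0 σ≢0 v = sym (begin
  ((1ℚ - p) ÷₀ (σ * p)) * v         ≡⟨ cong (_* v) (÷₀-as-* (1ℚ - p) (σ * p)) ⟩
  (1ℚ - p) * (1ℚ ÷₀ (σ * p)) * v    ≡⟨ cong (λ z → (1ℚ - p) * z * v) (inv₀-unique Mu*σp≡1) ⟩
  (1ℚ - p) * (M * u) * v            ≡⟨ regroup p M u v ⟩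
  (M - p * M) * v * u               ≡⟨ cong (λ z → (M - z) * v * u) pM≡1 ⟩
  (M - 1ℚ) * v * u                  ≡⟨ sym (÷₀-as-* ((M - 1ℚ) * v) σ) ⟩
  ((M - 1ℚ) * v) ÷₀ σ               ∎)
  where
  open ≡-Reasoning
  p = 1ℚ ÷₀ M
  u = 1ℚ ÷₀ σ
  pM≡1 : p * M ≡ 1ℚ
  pM≡1 = ÷₀-*-cancel 1ℚ M≢0
  Mu*σp≡1 : (M * u) * (σ * p) ≡ 1ℚ
  Mu*σp≡1 = begin
    (M * u) * (σ * p)   ≡⟨ swap M u σ p ⟩
    (p * M) * (u * σ)   ≡⟨ cong₂ _*_ pM≡1 (÷₀-*-cancel 1ℚ σ≢0) ⟩
    1ℚ * 1ℚ             ≡⟨ ℚ.*-identityˡ 1ℚ ⟩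
    1ℚ                  ∎
    where
    swap : ∀ M u σ p → (M * u) * (σ * p) ≡ (p * M) * (u * σ)
    swap = solve-∀ ℚ-ring
  regroup : ∀ p M u v → (1ℚ - p) * (M * u) * v ≡ (M - p * M) * v * u
  regroup = solve-∀ ℚ-ring

sampleMean : {A : Set} → (A → ℚ) → (s : ℕ) → Vec A s → ℚ
sampleMean F s t = sumVec (Vec.map F t) ÷₀ fromℕ s

sumVec-map-sub : ∀ {A : Set} {s} (F : A → ℚ) c (t : Vec A s) →
  sumVec (Vec.map (λ x → F x - c) t) ≡ sumVec (Vec.map F t) - fromℕ s * c
sumVec-map-sub F c []       = sym (trans (cong (λ z → 0ℚ - z) (ℚ.*-zeroˡ c)) (ℚ.+-inverseʳ 0ℚ))
sumVec-map-sub {s = suc s} F c (x ∷ t) = begin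
  F x - c + sumVec (Vec.map (λ x → F x - c) t)   ≡⟨ cong (F x - c +_) (sumVec-map-sub F c t) ⟩
  F x - c + (T - fromℕ s * c)                    ≡⟨ regroup (F x) T c (fromℕ s) ⟩
  F x + T - (1ℚ + fromℕ s) * c                   ≡⟨ cong (λ k → F x + T - k * c) (sym (fromℕ-suc s)) ⟩
  F x + T - fromℕ (suc s) * c                    ∎
  where
  open ≡-Reasoning
  T = sumVec (Vec.map F t)
  regroup : ∀ f T c k → f - c + (T - k * c) ≡ f + T - (1ℚ + k) * c
  regroup = solve-∀ ℚ-ring

module _ {A : Set} (xs : List A) (xs≢[] : 1 ℕ.≤ length xs) (F : A → ℚ) where

  meanSquareDeviation-sampleMean : ∀ s → 1 ℕ.≤ s →
    let μ = mean xs F in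
    mean (tuples xs s) (λ t → (sampleMean F s t - μ) * (sampleMean F s t - μ))
      ≡ mean xs (λ x → (F x - μ) * (F x - μ)) ÷₀ fromℕ s
  meanSquareDeviation-sampleMean s s≥1 = begin
    mean (tuples xs s) (λ t → (sampleMean F s t - μ) * (sampleMean F s t - μ))
      ≡⟨ mean-cong (tuples xs s) (λ t → cong (λ z → z * z) (deviation t)) ⟩
    mean (tuples xs s) (λ t → (u * S t) * (u * S t))
      ≡⟨ mean-cong (tuples xs s) (λ t → square-* u (S t)) ⟩
    mean (tuples xs s) (λ t → (u * u) * (S t * S t))
      ≡⟨ mean-*ˡ (tuples xs s) (u * u) (λ t → S t * S t) ⟩
    (u * u) * mean (tuples xs s) (λ t → S t * S t)
      ≡⟨ cong ((u * u) *_) (mean-square-sumVec xs xs≢[] G (mean-centred xs F xs≢[]) s) ⟩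
    (u * u) * (σ * EG²)
      ≡⟨ regroup u σ EG² ⟩
    (σ * u) * (EG² * u)
      ≡⟨ cong (_* (EG² * u)) σu≡1 ⟩
    1ℚ * (EG² * u)
      ≡⟨ ℚ.*-identityˡ _ ⟩
    EG² * u
      ≡⟨ sym (÷₀-as-* EG² σ) ⟩
    EG² ÷₀ σ
      ∎
    where
    open ≡-Reasoning
    μ = mean xs F
    σ = fromℕ s
    u = 1ℚ ÷₀ σ
    G : A → ℚ
    G x = F x - μ
    S : Vec A s → ℚ
    S t = sumVec (Vec.map G t)
    EG² = mean xs (λ x → G x * G x)
    square-* : ∀ a b → (a * b) * (a * b) ≡ (a * a) * (b * b)
    square-* = solve-∀ ℚ-ring
    regroup : ∀ u σ v → (u * u) * (σ * v) ≡ (σ * u) * (v * u)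
    regroup = solve-∀ ℚ-ring
    σu≡1 : σ * u ≡ 1ℚ
    σu≡1 = trans (ℚ.*-comm σ u) (÷₀-*-cancel 1ℚ (fromℕ-≢0 s≥1))
    deviation : ∀ t → sampleMean F s t - μ ≡ u * S t
    deviation t = begin
      T ÷₀ σ - μ            ≡⟨ cong (_- μ) (÷₀-as-* T σ) ⟩
      T * u - μ             ≡⟨ cong (λ z → T * u - z) (sym (trans (cong (μ *_) σu≡1) (ℚ.*-identityʳ μ))) ⟩
      T * u - μ * (σ * u)   ≡⟨ factor T u μ σ ⟩
      u * (T - σ * μ)       ≡⟨ cong (u *_) (sym (sumVec-map-sub F μ t)) ⟩
      u * S t               ∎
      where
      T = sumVec (Vec.map F t)
      factor : ∀ T u μ σ → T * u - μ * (σ * u) ≡ u * (T - σ * μ)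
      factor = solve-∀ ℚ-ring

  meanSquare≤ : (∀ x → 0ℚ ≤ F x) →
    mean xs (λ x → F x * F x) ≤ fromℕ (length xs) * (mean xs F * mean xs F)
  meanSquare≤ 0≤F = begin
    ∑ xs (λ x → F x * F x) ÷₀ M    ≤⟨ ÷₀-monoˡ-≤ M (fromℕ-nonNeg (length xs)) (∑-sq≤sq-∑ xs 0≤F) ⟩
    (∑ xs F * ∑ xs F) ÷₀ M         ≡⟨ cong (λ z → (z * z) ÷₀ M) (∑≡mean*length xs F) ⟩
    ((μ * M) * (μ * M)) ÷₀ M       ≡⟨ cong (_÷₀ M) (regroup μ M) ⟩
    ((M * (μ * μ)) * M) ÷₀ M       ≡⟨ *-÷₀-cancel _ (fromℕ-≢0 xs≢[]) ⟩
    M * (μ * μ)                    ∎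
    where
    open ℚ.≤-Reasoning
    M = fromℕ (length xs)
    μ = mean xs F
    regroup : ∀ μ M → (μ * M) * (μ * M) ≡ (M * (μ * μ)) * M
    regroup = solve-∀ ℚ-ring

  meanSquareDeviation≤ : (∀ x → 0ℚ ≤ F x) →
    let μ = mean xs F in
    mean xs (λ x → (F x - μ) * (F x - μ)) ≤ (fromℕ (length xs) - 1ℚ) * (μ * μ)
  meanSquareDeviation≤ 0≤F = begin
    mean xs (λ x → (F x - μ) * (F x - μ))
      ≡⟨ mean-cong xs (λ x → cong (λ z → z * z) (ℚ.+-comm (F x) (- μ))) ⟩
    mean xs (λ x → (- μ + F x) * (- μ + F x))
      ≡⟨ mean-square-shift xs (- μ) F xs≢[] ⟩
    - μ * - μ + ((- μ + - μ) * μ + mean xs (λ x → F x * F x))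
      ≤⟨ ℚ.+-monoʳ-≤ (- μ * - μ) (ℚ.+-monoʳ-≤ ((- μ + - μ) * μ) (meanSquare≤ 0≤F)) ⟩
    - μ * - μ + ((- μ + - μ) * μ + M * (μ * μ))
      ≡⟨ collect μ M ⟩
    (M - 1ℚ) * (μ * μ)
      ∎
    where
    open ℚ.≤-Reasoning
    M = fromℕ (length xs)
    μ = mean xs F
    collect : ∀ μ M → - μ * - μ + ((- μ + - μ) * μ + M * (μ * μ)) ≡ (M - 1ℚ) * (μ * μ)
    collect = solve-∀ ℚ-ring

  variance-sampleMean≤ : (∀ x → 0ℚ ≤ F x) → ∀ s → 1 ℕ.≤ s →
    let μ = mean xs F
        p = 1ℚ ÷₀ fromℕ (length xs)
    in Var xs s (sampleMean F s) ≤ ((1ℚ - p) ÷₀ (fromℕ s * p)) * (μ * μ)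
  variance-sampleMean≤ 0≤F s s≥1 = begin
    Var xs s (sampleMean F s)
      ≤⟨ variance≤meanSquareDeviation (tuples xs s) (sampleMean F s) μ (tuples≢[] xs xs≢[] s) ⟩
    mean (tuples xs s) (λ t → (sampleMean F s t - μ) * (sampleMean F s t - μ))
      ≡⟨ meanSquareDeviation-sampleMean s s≥1 ⟩
    mean xs (λ x → (F x - μ) * (F x - μ)) ÷₀ fromℕ s
      ≤⟨ ÷₀-monoˡ-≤ (fromℕ s) (fromℕ-nonNeg s) (meanSquareDeviation≤ 0≤F) ⟩
    ((fromℕ (length xs) - 1ℚ) * (μ * μ)) ÷₀ fromℕ s
      ≡⟨ [M-1]v/σ≡[1-p]v/[σp] (fromℕ-≢0 xs≢[]) (fromℕ-≢0 s≥1) (μ * μ) ⟩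
    ((1ℚ - p) ÷₀ (fromℕ s * p)) * (μ * μ)
      ∎
    where
    open ℚ.≤-Reasoning
    μ = mean xs F
    p = 1ℚ ÷₀ fromℕ (length xs)

module _ {n : ℕ} (G : SimpleGraph n) where

  private
    indicator : Bool → ℚ
    indicator b = if b then 1ℚ else 0ℚ

  ∑-aq : ∀ q v → ∑ (edges G) (aq G q v) ≡ fromℕ (triV G v)
  ∑-aq q v = begin
    ∑ (edges G) (aq G q v)
      ≡⟨ ∑-cong (edges G) (λ e → cong₂ _+_ (incident e) (cong (c *_) (common e))) ⟩
    ∑ (edges G) (λ e → q * fromℕ (g₁ e) + c * fromℕ (g₂ e))
      ≡⟨ ∑-distrib (edges G) _ _ ⟩
    ∑ (edges G) (λ e → q * fromℕ (g₁ e)) + ∑ (edges G) (λ e → c * fromℕ (g₂ e))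
      ≡⟨ cong₂ _+_ (∑-*ˡ (edges G) q _) (∑-*ˡ (edges G) c _) ⟩
    q * ∑ (edges G) (λ e → fromℕ (g₁ e)) + c * ∑ (edges G) (λ e → fromℕ (g₂ e))
      ≡⟨ sym (cong₂ (λ a b → q * a + c * b) (fromℕ-∑ (edges G) g₁) (fromℕ-∑ (edges G) g₂)) ⟩
    q * fromℕ (ℕΣ.∑ (edges G) g₁) + c * fromℕ (ℕΣ.∑ (edges G) g₂)
      ≡⟨ cong₂ (λ a b → q * fromℕ a + c * fromℕ b)
               (∑-incident-triE G v) (sym (length-filter≡∑ _ (edges G))) ⟩
    q * fromℕ (2 ℕ.* t) + c * fromℕ t
      ≡⟨ cong (λ z → q * z + c * fromℕ t) (fromℕ-* 2 t) ⟩
    q * (fromℕ 2 * fromℕ t) + (1ℚ - fromℕ 2 * q) * fromℕ t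
      ≡⟨ cancel q (fromℕ 2) (fromℕ t) ⟩
    fromℕ t
      ∎
    where
    open ≡-Reasoning
    t = triV G v
    c = 1ℚ - fromℕ 2 * q
    g₁ g₂ : Fin n × Fin n → ℕ
    g₁ e = if inE G e v then triE G e else 0
    g₂ e = if inNe G e v then 1 else 0
    incident : ∀ e → q * fromℕ (triE G e) * indicator (inE G e v) ≡ q * fromℕ (g₁ e)
    incident e with inE G e v
    ... | true  = ℚ.*-identityʳ _
    ... | false = trans (ℚ.*-zeroʳ (q * fromℕ (triE G e))) (sym (ℚ.*-zeroʳ q))
    common : ∀ e → indicator (inNe G e v) ≡ fromℕ (g₂ e)
    common e with inNe G e v
    ... | true  = refl
    ... | false = refl
    cancel : ∀ q two t → q * (two * t) + (1ℚ - two * q) * t ≡ t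
    cancel = solve-∀ ℚ-ring

  module _ {k : ℕ} (ψ : Coeff) (q : ℚ) (part : Fin n → Fin k) (j : Fin k) where

    private
      P = inPart G part j
      M = fromℕ (numEdges G)
      C = fromℕ (count P)

    ∑-Fj : ∑ (edges G) (Fj G ψ q part j) ≡ M * meanPsi G ψ part j
    ∑-Fj = begin
      ∑ (edges G) (λ e → (M ÷₀ C) * ∑ vs (λ v → if P v then aq G q v e ÷₀ Wstar G ψ v else 0ℚ))
        ≡⟨ ∑-*ˡ (edges G) (M ÷₀ C) _ ⟩
      (M ÷₀ C) * ∑ (edges G) (λ e → ∑ vs (λ v → if P v then aq G q v e ÷₀ Wstar G ψ v else 0ℚ))
        ≡⟨ cong ((M ÷₀ C) *_) (∑-comm (edges G) vs _) ⟩
      (M ÷₀ C) * ∑ vs (λ v → ∑ (edges G) (λ e → if P v then aq G q v e ÷₀ Wstar G ψ v else 0ℚ))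
        ≡⟨ cong ((M ÷₀ C) *_) (∑-cong vs (λ v → trans (∑-if (edges G) (P v) _)
                                                       (cong (λ z → if P v then z else 0ℚ) (∑-psi v)))) ⟩
      (M ÷₀ C) * ∑ vs (λ v → if P v then psi G ψ v else 0ℚ)
        ≡⟨ cong (_* sumOver P (psi G ψ)) (÷₀-as-* M C) ⟩
      M * (1ℚ ÷₀ C) * sumOver P (psi G ψ)
        ≡⟨ regroup M (1ℚ ÷₀ C) _ ⟩
      M * (sumOver P (psi G ψ) * (1ℚ ÷₀ C))
        ≡⟨ cong (M *_) (sym (÷₀-as-* _ C)) ⟩
      M * meanPsi G ψ part j
        ∎
      where
      open ≡-Reasoning
      vs = allFin n
      ∑-psi : ∀ v → ∑ (edges G) (λ e → aq G q v e ÷₀ Wstar G ψ v) ≡ psi G ψ v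
      ∑-psi v = trans (∑-÷₀ (edges G) (Wstar G ψ v) (aq G q v)) (cong (_÷₀ Wstar G ψ v) (∑-aq q v))
      regroup : ∀ M c S → M * c * S ≡ M * (S * c)
      regroup = solve-∀ ℚ-ring

    Fj-unbiased : 1 ℕ.≤ numEdges G → mean (edges G) (Fj G ψ q part j) ≡ meanPsi G ψ part j
    Fj-unbiased m≢0 = trans (cong (_÷₀ M) (trans ∑-Fj (ℚ.*-comm M _))) (*-÷₀-cancel _ (fromℕ-≢0 m≢0))

    Fj-nonNeg : 0ℚ ≤ q → q ≤ ½ → ∀ e → 0ℚ ≤ Fj G ψ q part j e
    Fj-nonNeg 0≤q q≤½ e =
      *-nonNeg (÷₀-nonNeg (fromℕ-nonNeg (numEdges G)) (fromℕ-nonNeg (count P)))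
               (∑-nonNeg (allFin n) term≥0)
      where
      indicator≥0 : ∀ b → 0ℚ ≤ indicator b
      indicator≥0 true  = ℚ.nonNegative⁻¹ 1ℚ
      indicator≥0 false = ℚ.≤-refl
      1-2q≥0 : 0ℚ ≤ 1ℚ - fromℕ 2 * q
      1-2q≥0 = begin
        0ℚ                          ≡⟨ sym (ℚ.+-inverseʳ (fromℕ 2 * q)) ⟩
        fromℕ 2 * q - fromℕ 2 * q   ≤⟨ ℚ.+-monoˡ-≤ (- (fromℕ 2 * q)) (ℚ.*-monoˡ-≤-nonNeg (fromℕ 2) q≤½) ⟩
        1ℚ - fromℕ 2 * q            ∎
        where open ℚ.≤-Reasoning
      aq≥0 : ∀ v → 0ℚ ≤ aq G q v e
      aq≥0 v = ℚ.+-mono-≤ (*-nonNeg (*-nonNeg 0≤q (fromℕ-nonNeg (triE G e))) (indicator≥0 (inE G e v)))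
                          (*-nonNeg 1-2q≥0 (indicator≥0 (inNe G e v)))
      Wstar≥0 : ∀ ψ v → 0ℚ ≤ Wstar G ψ v
      Wstar≥0 α v = fromℕ-nonNeg (Wc G v)
      Wstar≥0 φ v = *-nonNeg (fromℕ-nonNeg (Wh G v)) (ℚ.nonNegative⁻¹ ½)
      term≥0 : ∀ v → 0ℚ ≤ (if P v then aq G q v e ÷₀ Wstar G ψ v else 0ℚ)
      term≥0 v with P v
      ... | true  = ÷₀-nonNeg (aq≥0 v) (Wstar≥0 ψ v)
      ... | false = ℚ.≤-refl

-- The parts need not be nonempty: for an empty part F_j and the mean of ψ both vanish (x ÷₀ 0 = 0).
lemma3p5 : ∀ {n k : ℕ} (G : SimpleGraph n) → numEdges G ≥ 1 →
    (part : Fin n → Fin k) → (∀ j → ∃ λ v → part v ≡ j) →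
    (ψ : Coeff) (q : ℚ) → 0ℚ ≤ q → q ≤ ½ →
    (s : ℕ) → s ≥ 1 →
    let m = numEdges G
        p = 1ℚ ÷₀ fromℕ m
    in ∀ (j : Fin k) →
      Var (edges G) s (fj G ψ q part j s)
        ≤ ((1ℚ - p) ÷₀ (fromℕ s * p)) * (meanPsi G ψ part j * meanPsi G ψ part j)
lemma3p5 G m≥1 part _ ψ q 0≤q q≤½ s s≥1 j =
  subst (λ μ → Var (edges G) s (fj G ψ q part j s) ≤ factor * (μ * μ))
        (Fj-unbiased G ψ q part j m≥1)
        (variance-sampleMean≤ (edges G) m≥1 (Fj G ψ q part j) (Fj-nonNeg G ψ q part j 0≤q q≤½) s s≥1)
  where
  p = 1ℚ ÷₀ fromℕ (numEdges G)
  factor = (1ℚ - p) ÷₀ (fromℕ s * p)
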